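{- Let $G$ be an abelian group and $\mathcal A=(A_1,\dots,A_q)$ a tuple of subsets of $G$, each of which is a finite union of bounded or unbounded generalized arithmetic progressions. Then for every $r\in\mathbb N$, $\mathcal A$ is a chromatic asymptotic $(r,\ell)$-approximate group for some finite $\ell$. More precisely, if each bounded progression occurring in the union for $A_i$ is refined into the singletons $\{x\}=P(x;0)$ of its elements, and $s_i$ denotes the total number of resulting unbounded linear pieces of $A_i$, then one may take $\ell=\prod_{i=1}^q\binom{(r+1)(s_i-1)}{s_i-1}$.
   Context: $\mathbb N=\{1,2,\dots\}$, $\mathbb N_0=\{0,1,2,\dots\}$. An unbounded generalized arithmetic progression (unbounded linear set) is $P(a;b_1,\dots,b_d)=\{a+n_1b_1+\cdots+n_db_d:n_j\in\mathbb N_0\}$; a bounded one is $P_{m_1,\dots,m_d}(a;b_1,\dots,b_d)=\{a+n_1b_1+\cdots+n_db_d:0\le n_j\le m_j\}$ with $m_j\in\mathbb N_0$. For subsets $X,Y$, $X+Y=\{x+y:x\in X,y\in Y\}$; $hA$ is the $h$-fold sumset, $0A=\{0\}$. For $\mathbf h\in\mathbb N_0^q$, $\mathbf h\cdot\mathcal A=h_1A_1+\cdots+h_qA_q$, $r\mathbf h=(rh_1,\dots,rh_q)$, and $\mathbf h\preceq\mathbf h'$ means coordinatewise $\le$. $\mathcal A$ is a chromatic asymptotic $(r,\ell)$-approximate group if there is $\mathbf h_0$ such that for every $\mathbf h\succeq\mathbf h_0$ there is $X_{\mathbf h}\subseteq G$ with $|X_{\mathbf h}|\le\ell$ and $(r\mathbf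 h)\cdot\mathcal A\subseteq X_{\mathbf h}+\mathbf h\cdot\mathcal A$. -}

module Defs where

open import Level using (Level; _⊔_; Lift)
open import Algebra.Bundles using (AbelianGroup)
open import Data.Nat using (ℕ; zero; suc; _*_; _∸_; _≤_)
open import Data.Nat.Combinatorics using (_C_)
open import Data.Fin using (Fin; zero; suc)
open import Data.Product using (Σ; _×_; ∃; ∃-syntax; _,_)
open import Data.Sum using (_⊎_)
open import Data.List using (List; []; _∷_; _++_; map; length)
open import Data.List.Relation.Unary.Any using (Any)
open import Data.List.Relation.Unary.All using (All)
open import Data.List.Relation.Unary.AllPairs using (AllPairs)
open import Data.Vec.Functional using (Vector)
open import Relation.Nullary using (¬_)
import Algebra.Definitions.RawMonoid as RM

prodFin : (q : ℕ) → (Fin q → ℕ) → ℕ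
prodFin zero    f = 1
prodFin (suc q) f = f zero * prodFin q (λ i → f (suc i))

module GAP {c ℓ : Level} (G : AbelianGroup c ℓ) where
  open AbelianGroup G
  open RM rawMonoid using (sum) renaming (_×_ to _·_)

  Pred : Set (Level.suc (c ⊔ ℓ))
  Pred = Carrier → Set (c ⊔ ℓ)

  record ULin : Set c where
    constructor ulin
    field
      dim  : ℕ
      base : Carrier
      gens : Fin dim → Carrier

  record BGAP : Set c where
    constructor bgap
    field
      dim    : ℕ
      base   : Carrier
      gens   : Fin dim → Carrier
      bounds : Fin dim → ℕ

  _∈U_ : Carrier → ULin → Set ℓ
  x ∈U ulin d a b = Σ (Fin d → ℕ) λ n → (x ≈ a ∙ sum (λ j → n j · b j))

  _∈B_ : Carrier → BGAP → Set ℓ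
  x ∈B bgap d a b m = Σ (Fin d → ℕ) λ n → ((∀ j → n j ≤ m j) × (x ≈ a ∙ sum (λ j → n j · b j)))

  data Piece : Set c where
    bounded   : BGAP → Piece
    unbounded : ULin → Piece

  _∈P_ : Carrier → Piece → Set ℓ
  x ∈P bounded B   = x ∈B B
  x ∈P unbounded U = x ∈U U

  ⟦_⟧ : List Piece → Pred
  ⟦ ps ⟧ x = Lift c (Any (x ∈P_) ps)

  single : Carrier → ULin
  single x = ulin 1 x (λ _ → ε)

  Enumerates : BGAP → List Carrier → Set (c ⊔ ℓ)
  Enumerates B xs =
    (∀ x → x ∈B B → Any (x ≈_) xs) × All (_∈B B) xs × AllPairs (λ u v → ¬ (u ≈ v)) xs

  data Refines : List Piece → List ULin → Set (c ⊔ ℓ) where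
    []ʳ  : Refines [] []
    unbʳ : ∀ {U ps qs} → Refines ps qs → Refines (unbounded U ∷ ps) (U ∷ qs)
    bndʳ : ∀ {B ps qs xs} → Enumerates B xs → Refines ps qs →
           Refines (bounded B ∷ ps) (map single xs ++ qs)

  _⊗_ : ℕ → Pred → Pred
  (h ⊗ A) x = Σ (Fin h → Carrier) λ y → (∀ k → A (y k)) × (x ≈ sum y)

  dotSum : (q : ℕ) → (Fin q → ℕ) → (Fin q → Pred) → Pred
  dotSum q h 𝒜 x = Σ (Fin q → Carrier) λ y → (∀ i → (h i ⊗ 𝒜 i) (y i)) × (x ≈ sum y)

  ChromaticAsymptoticApproxGroup : (q : ℕ) → (Fin q → Pred) → (r ℓ' : ℕ) → Set (c ⊔ ℓ)
  ChromaticAsymptoticApproxGroup q 𝒜 r ℓ' =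
    Σ (Fin q → ℕ) λ h₀ → ∀ (h : Fin q → ℕ) → (∀ i → h₀ i ≤ h i) →
      Σ (List Carrier) λ X → (length X ≤ ℓ') ×
        (∀ x → dotSum q (λ i → r * h i) 𝒜 x →
           Σ Carrier λ y → (Any (λ x′ → x ≈ x′ ∙ y) X × dotSum q h 𝒜 y))

  ellBound : (q : ℕ) → (Fin q → ℕ) → ℕ → ℕ
  ellBound q s r = prodFin q (λ i → ((suc r) * (s i ∸ 1)) C (s i ∸ 1))

{-# OPTIONS --safe #-}
module Submission where

open import Defs
open import Level using (Level)
open import Algebra.Bundles using (AbelianGroup; CommutativeMonoid)
open import Data.Nat using (ℕ; zero; suc; _+_; _*_; _∸_; _≤_)
open import Data.Nat.Properties using (+-0-commutativeMonoid; *-mono-≤; ≤-refl)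
open import Data.Nat.Combinatorics using (_C_)
open import Data.Fin using (Fin; zero; suc)
open import Data.Vec.Functional using (Vector; tail; updateAt) renaming (_∷_ to _◂_)
open import Data.List using (List; []; _∷_; [_]; map; length; cartesianProductWith)
open import Data.List.Properties using (length-map; length-++)
open import Data.List.Membership.Propositional using (_∈_)
open import Data.List.Membership.Propositional.Properties using (∈-map⁺)
open import Data.Product using (Σ; _×_; _,_; proj₁; proj₂)
open import Function using (_∘_)
open import Relation.Binary.PropositionalEquality as ≡ using (_≡_)
open import Algebra.Properties.CommutativeMonoid.Sum +-0-commutativeMonoid using () renaming (sum to ∑ℕ)

-- Refining every bounded progression into singletons, A is a union of s unbounded linear
-- sets P(a_j; B_j), and an element of kA is Σ_j (k_j a_j + p_j) with Σ_j k_j = k, p_j in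
-- the monoid generated by B_j, and p_j = 0 whenever k_j = 0.  For y ∈ (rh)A pick a block
-- length w ≈ h/(s−1) and write k_j = ρ_j + w e_j for j ≥ 1 with 1 ≤ ρ_j ≤ w unless k_j = 0.
-- Keeping ρ_j copies of the j-th piece and h − Σρ_j ≥ 1 copies of the 0-th one gives
-- y = x + z with z ∈ hA and x = Σ_{j≥1} w e_j a_j + ((r−1)h − w Σe_j) a_0, which depends on
-- e alone; since Σe_j ≤ r(s−1) there are at most C((r+1)(s−1), s−1) such x.  For a tuple
-- (A_1, …, A_q) the translates are added coordinatewise and the counts multiply.

module Counting where

  open import Data.Nat using (_<_; z≤n; s≤s; s≤s⁻¹; z<s; NonZero; >-nonZero)
  open import Data.Nat.Properties
  open import Data.Nat.DivMod using (_/_; _%_; m≡m%n+[m/n]*n; m%n<n; m/n*n≤m; m*n/n≡m; /-monoˡ-≤)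
  open import Data.Nat.Combinatorics using (nCn≡1; nCk+nC[k+1]≡[n+1]C[k+1])
  open import Data.Nat.Solver using (module +-*-Solver)
  open +-*-Solver using (solve; _:=_; _:+_; _:*_; con)
  open import Data.Vec using (Vec; []; _∷_; lookup; tabulate)
  open import Data.Vec.Properties using (lookup∘tabulate)
  open import Data.List using (_++_)
  open import Data.List.Membership.Propositional.Properties using (∈-++⁺ˡ; ∈-++⁺ʳ)
  open import Data.List.Relation.Unary.Any using (here)
  open import Relation.Binary.PropositionalEquality using (refl; sym; trans; cong; cong₂; module ≡-Reasoning)
  open import Relation.Nullary using (contradiction)
  open import Algebra.Properties.CommutativeMonoid.Sum +-0-commutativeMonoid using (sum-cong-≗; ∑-distrib-+)
  open import Algebra.Properties.Semiring.Sum +-*-semiring using (*-distribʳ-sum)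

  incrementHead : ∀ {t} → Vec ℕ (suc t) → Vec ℕ (suc t)
  incrementHead (x ∷ v) = suc x ∷ v

  boundedVectors : ∀ t → ℕ → List (Vec ℕ t)
  boundedVectors zero    N       = [ [] ]
  boundedVectors (suc t) zero    = map (0 ∷_) (boundedVectors t zero)
  boundedVectors (suc t) (suc N) =
    map (0 ∷_) (boundedVectors t (suc N)) ++ map incrementHead (boundedVectors (suc t) N)

  length-boundedVectors : ∀ t N → length (boundedVectors t N) ≡ (N + t) C t
  length-boundedVectors zero    N    = refl
  length-boundedVectors (suc t) zero = begin
    length (map (0 ∷_) (boundedVectors t 0)) ≡⟨ length-map _ (boundedVectors t 0) ⟩
    length (boundedVectors t 0)              ≡⟨ length-boundedVectors t 0 ⟩
    t C t                                    ≡⟨ nCn≡1 t ⟩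
    1                                        ≡⟨ nCn≡1 (suc t) ⟨
    suc t C suc t                            ∎
    where open ≡-Reasoning
  length-boundedVectors (suc t) (suc N) = begin
    length (map (0 ∷_) (boundedVectors t (suc N)) ++ map incrementHead (boundedVectors (suc t) N))
      ≡⟨ length-++ (map (0 ∷_) (boundedVectors t (suc N))) ⟩
    length (map (0 ∷_) (boundedVectors t (suc N))) + length (map incrementHead (boundedVectors (suc t) N))
      ≡⟨ cong₂ _+_ (length-map _ (boundedVectors t (suc N))) (length-map incrementHead (boundedVectors (suc t) N)) ⟩
    length (boundedVectors t (suc N)) + length (boundedVectors (suc t) N)
      ≡⟨ cong₂ _+_ (length-boundedVectors t (suc N)) (length-boundedVectors (suc t) N) ⟩
    (suc N + t) C t + (N + suc t) C suc t
      ≡⟨ cong (λ n → n C t + (N + suc t) C suc t) (+-suc N t) ⟨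
    (N + suc t) C t + (N + suc t) C suc t
      ≡⟨ nCk+nC[k+1]≡[n+1]C[k+1] (N + suc t) t ⟩
    suc (N + suc t) C suc t ∎
    where open ≡-Reasoning

  ∈-boundedVectors : ∀ {t N} (v : Vec ℕ t) → ∑ℕ (lookup v) ≤ N → v ∈ boundedVectors t N
  ∈-boundedVectors []                          _         = here refl
  ∈-boundedVectors {N = zero}  (zero  ∷ v) ∑v≤0      = ∈-map⁺ (0 ∷_) (∈-boundedVectors v ∑v≤0)
  ∈-boundedVectors {N = suc N} (zero  ∷ v) ∑v≤1+N    = ∈-++⁺ˡ (∈-map⁺ (0 ∷_) (∈-boundedVectors v ∑v≤1+N))
  ∈-boundedVectors {N = suc N} (suc x ∷ v) (s≤s ∑≤N) =
    ∈-++⁺ʳ _ (∈-map⁺ incrementHead (∈-boundedVectors (x ∷ v) ∑≤N))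

  ∑ℕ-≤-* : ∀ {n} (f : Vector ℕ n) {b} → (∀ i → f i ≤ b) → ∑ℕ f ≤ n * b
  ∑ℕ-≤-* {zero}  f f≤b = z≤n
  ∑ℕ-≤-* {suc n} f f≤b = +-mono-≤ (f≤b zero) (∑ℕ-≤-* (f ∘ suc) (f≤b ∘ suc))

  -- Division with remainder in [1, w] rather than [0, w), so that only 0 has remainder 0.
  remainder⁺ quotient⁺ : ∀ w .{{_ : NonZero w}} → ℕ → ℕ
  remainder⁺ w zero    = 0
  remainder⁺ w (suc k) = suc (k % w)
  quotient⁺  w zero    = 0
  quotient⁺  w (suc k) = k / w

  k≡remainder⁺+quotient⁺*w : ∀ w .{{_ : NonZero w}} k → k ≡ remainder⁺ w k + quotient⁺ w k * w
  k≡remainder⁺+quotient⁺*w w zero    = refl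
  k≡remainder⁺+quotient⁺*w w (suc k) = cong suc (m≡m%n+[m/n]*n k w)

  remainder⁺≤w : ∀ w .{{_ : NonZero w}} k → remainder⁺ w k ≤ w
  remainder⁺≤w w zero    = z≤n
  remainder⁺≤w w (suc k) = m%n<n k w

  remainder⁺≡0⇒k≡0 : ∀ w .{{_ : NonZero w}} k → remainder⁺ w k ≡ 0 → k ≡ 0
  remainder⁺≡0⇒k≡0 w zero    _  = refl
  remainder⁺≡0⇒k≡0 w (suc k) ()

  private
    blockLength⁺ : ∀ t .{{_ : NonZero t}} r m → t * suc (r * t) ≤ m →
      Σ ℕ λ w → 0 < w × t * w < suc m × r * suc m < suc (r * t) * w
    blockLength⁺ t r m t[rt+1]≤m = w , <-≤-trans z<s rt<w , s≤s tw≤m , rh<[rt+1]w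
      where
      open ≤-Reasoning
      w : ℕ
      w = m / t
      rt<w : r * t < w
      rt<w = begin-strict
        r * t                  <⟨ n<1+n (r * t) ⟩
        suc (r * t)            ≡⟨ m*n/n≡m (suc (r * t)) t ⟨
        suc (r * t) * t / t    ≤⟨ /-monoˡ-≤ t (≤-trans (≤-reflexive (solve 2 (λ r t → (con 1 :+ r :* t) :* t := t :* (con 1 :+ r :* t)) refl r t)) t[rt+1]≤m) ⟩
        w                      ∎
      tw≤m : t * w ≤ m
      tw≤m = ≤-trans (≤-reflexive (*-comm t w)) (m/n*n≤m m t)
      m<t[1+w] : m < t * suc w
      m<t[1+w] = begin-strict
        m                 ≡⟨ m≡m%n+[m/n]*n m t ⟩
        m % t + w * t     <⟨ +-monoˡ-< (w * t) (m%n<n m t) ⟩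
        t + w * t         ≡⟨ solve 2 (λ t w → t :+ w :* t := t :* (con 1 :+ w)) refl t w ⟩
        t * suc w         ∎
      rh<[rt+1]w : r * suc m < suc (r * t) * w
      rh<[rt+1]w = begin-strict
        r * suc m             ≤⟨ *-monoʳ-≤ r m<t[1+w] ⟩
        r * (t * suc w)       ≡⟨ solve 3 (λ r t w → r :* (t :* (con 1 :+ w)) := r :* t :+ r :* t :* w) refl r t w ⟩
        r * t + r * t * w     <⟨ +-monoˡ-< (r * t * w) rt<w ⟩
        w + r * t * w         ≡⟨ solve 3 (λ r t w → w :+ r :* t :* w := (con 1 :+ r :* t) :* w) refl r t w ⟩
        suc (r * t) * w       ∎

  -- t w < h leaves at least one summand for the 0-th piece, and r h < (1 + r t) w
  -- bounds the total of the quotients by r t.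
  blockLength : ∀ t r h → t * suc (r * t) < h →
    Σ ℕ λ w → 0 < w × t * w < h × r * h < suc (r * t) * w
  blockLength zero r h 0<h = suc (r * h) , z<s , 0<h , (begin-strict
    r * h                         <⟨ n<1+n (r * h) ⟩
    suc (r * h)                   ≡⟨ *-identityˡ (suc (r * h)) ⟨
    1 * suc (r * h)               ≡⟨ cong (λ n → suc n * suc (r * h)) (*-zeroʳ r) ⟨
    suc (r * 0) * suc (r * h)     ∎)
    where open ≤-Reasoning
  blockLength t@(suc _) r (suc m) (s≤s t[rt+1]≤m) = blockLength⁺ t r m t[rt+1]≤m

  Shift : ℕ → Set
  Shift s = Vector ℕ s × Vector ℕ s

  -- The integer vector k − target = up − down, drawn from the finite list Δ, is what
  -- determines the translate in the group.
  record Rebalancing {s} (k : Vector ℕ s) (h : ℕ) (Δ : List (Shift s)) : Set where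
    field
      target  : Vector ℕ s
      ∑target : ∑ℕ target ≡ h
      support : ∀ j → target j ≡ 0 → k j ≡ 0
      up down : Vector ℕ s
      shift∈Δ : (up , down) ∈ Δ
      balance : ∀ j → k j + down j ≡ target j + up j

  shiftOf : ∀ {t} (u₀ w : ℕ) → Vec ℕ t → Shift (suc t)
  shiftOf u₀ w e = (u₀ ◂ λ i → lookup e i * w) , (∑ℕ (lookup e) * w ◂ λ _ → 0)

  module _ (t r h w : ℕ) .{{_ : NonZero w}}
           (tw<h : t * w < h) (rh<[1+rt]w : suc r * h < suc (suc r * t) * w) where

    rebalance : ∀ k → ∑ℕ k ≡ suc r * h →
      Rebalancing k h (map (shiftOf (r * h) w) (boundedVectors t (suc r * t)))
    rebalance k ∑k≡[1+r]h = record
      { target  = h ∸ ∑ρ ◂ ρ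
      ; ∑target = m∸n+n≡m (<⇒≤ ∑ρ<h)
      ; support = support
      ; shift∈Δ = ∈-map⁺ (shiftOf (r * h) w) (∈-boundedVectors e ∑e≤[1+r]t)
      ; balance = balance
      }
      where
      ρ : Vector ℕ t
      ρ i = remainder⁺ w (k (suc i))
      e : Vec ℕ t
      e = tabulate (λ i → quotient⁺ w (k (suc i)))
      ∑ρ = ∑ℕ ρ
      ∑e = ∑ℕ (lookup e)

      k-split : ∀ i → k (suc i) ≡ ρ i + lookup e i * w
      k-split i = trans (k≡remainder⁺+quotient⁺*w w (k (suc i)))
                        (cong (λ q → ρ i + q * w) (sym (lookup∘tabulate _ i)))

      ∑ρ<h : ∑ρ < h
      ∑ρ<h = ≤-<-trans (∑ℕ-≤-* ρ (λ i → remainder⁺≤w w (k (suc i)))) tw<h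

      ∑tail : ∑ℕ (k ∘ suc) ≡ ∑ρ + ∑e * w
      ∑tail = trans (sum-cong-≗ k-split)
                    (trans (∑-distrib-+ ρ _) (cong (∑ρ +_) (sym (*-distribʳ-sum w (lookup e)))))

      ∑e≤[1+r]t : ∑e ≤ suc r * t
      ∑e≤[1+r]t = s≤s⁻¹ (*-cancelʳ-< w ∑e (suc (suc r * t)) (begin-strict
        ∑e * w                 ≤⟨ m≤n+m (∑e * w) (k zero + ∑ρ) ⟩
        k zero + ∑ρ + ∑e * w   ≡⟨ +-assoc (k zero) ∑ρ (∑e * w) ⟩
        k zero + (∑ρ + ∑e * w) ≡⟨ cong (k zero +_) ∑tail ⟨
        ∑ℕ k                   ≡⟨ ∑k≡[1+r]h ⟩
        suc r * h              <⟨ rh<[1+rt]w ⟩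
        suc (suc r * t) * w    ∎))
        where open ≤-Reasoning

      support : ∀ j → (h ∸ ∑ρ ◂ ρ) j ≡ 0 → k j ≡ 0
      support zero    h∸∑ρ≡0 = contradiction h∸∑ρ≡0 (m>n⇒m∸n≢0 ∑ρ<h)
      support (suc i) = remainder⁺≡0⇒k≡0 w (k (suc i))

      balance : ∀ j → k j + proj₂ (shiftOf (r * h) w e) j ≡ (h ∸ ∑ρ ◂ ρ) j + proj₁ (shiftOf (r * h) w e) j
      balance zero    = +-cancelʳ-≡ ∑ρ _ _ (begin
        k zero + ∑e * w + ∑ρ           ≡⟨ solve 3 (λ a b c → a :+ b :+ c := a :+ (c :+ b)) refl (k zero) (∑e * w) ∑ρ ⟩
        k zero + (∑ρ + ∑e * w)         ≡⟨ cong (k zero +_) ∑tail ⟨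
        ∑ℕ k                           ≡⟨ ∑k≡[1+r]h ⟩
        h + r * h                      ≡⟨ cong (_+ r * h) (m∸n+n≡m (<⇒≤ ∑ρ<h)) ⟨
        h ∸ ∑ρ + ∑ρ + r * h            ≡⟨ solve 3 (λ a b c → a :+ b :+ c := a :+ c :+ b) refl (h ∸ ∑ρ) ∑ρ (r * h) ⟩
        h ∸ ∑ρ + r * h + ∑ρ            ∎)
        where open ≡-Reasoning
      balance (suc i) = trans (+-identityʳ (k (suc i))) (k-split i)

  rebalancing : ∀ s r → Σ ℕ λ h₀ → ∀ h → h₀ ≤ h → Σ (List (Shift s)) λ Δ →
    length Δ ≤ (suc (suc r) * (s ∸ 1)) C (s ∸ 1) × (∀ k → ∑ℕ k ≡ suc r * h → Rebalancing k h Δ)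
  rebalancing zero    r = 1 , λ { (suc h) _ → [] , z≤n , λ _ () }
  rebalancing (suc t) r = suc (t * suc (suc r * t)) , Δ-for
    where
    Δ-for : ∀ h → suc (t * suc (suc r * t)) ≤ h → Σ (List (Shift (suc t))) λ Δ →
      length Δ ≤ (suc (suc r) * t) C t × (∀ k → ∑ℕ k ≡ suc r * h → Rebalancing k h Δ)
    Δ-for h h₀≤h with blockLength t (suc r) h h₀≤h
    ... | w , 0<w , tw<h , rh<[1+rt]w =
      map (shiftOf (r * h) w) (boundedVectors t (suc r * t)) ,
      ≤-reflexive (trans (length-map (shiftOf (r * h) w) (boundedVectors t (suc r * t)))
                  (trans (length-boundedVectors t (suc r * t)) (cong (_C t) (+-comm (suc r * t) t)))) ,
      rebalance t r h w ⦃ >-nonZero 0<w ⦄ tw<h rh<[1+rt]w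

open Counting

length-cartesianProductWith : ∀ {a b c} {A : Set a} {B : Set b} {C : Set c} (f : A → B → C) xs ys →
  length (cartesianProductWith f xs ys) ≡ length xs * length ys
length-cartesianProductWith f []       ys = ≡.refl
length-cartesianProductWith f (x ∷ xs) ys = ≡.trans (length-++ (map (f x) ys))
  (≡.cong₂ _+_ (length-map (f x) ys) (length-cartesianProductWith f xs ys))

prodFin-mono-≤ : ∀ q {f g : Fin q → ℕ} → (∀ i → f i ≤ g i) → prodFin q f ≤ prodFin q g
prodFin-mono-≤ zero    f≤g = ≤-refl
prodFin-mono-≤ (suc q) f≤g = *-mono-≤ (f≤g zero) (prodFin-mono-≤ q (f≤g ∘ suc))

updateAt-pointwise : ∀ {a b r n} {A : Set a} {B : Set b} (R : Fin n → A → B → Set r) {xs ys} i {f g} →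
  (∀ j → R j (xs j) (ys j)) → R i (f (xs i)) (g (ys i)) → ∀ j → R j (updateAt xs i f j) (updateAt ys i g j)
updateAt-pointwise R zero    old new zero    = new
updateAt-pointwise R zero    old new (suc j) = old (suc j)
updateAt-pointwise R (suc i) old new zero    = old zero
updateAt-pointwise R (suc i) old new (suc j) = updateAt-pointwise (R ∘ suc) i (old ∘ suc) new j

module _ {a ℓ} (M : CommutativeMonoid a ℓ) where
  open CommutativeMonoid M
  open import Algebra.Definitions.RawMonoid rawMonoid using (sum)
  open import Algebra.Properties.CommutativeSemigroup commutativeSemigroup using (x∙yz≈y∙xz)

  sum-updateAt : ∀ {n} (xs : Vector Carrier n) i x → sum (updateAt xs i (x ∙_)) ≈ x ∙ sum xs
  sum-updateAt xs zero    x = assoc x (xs zero) (sum (tail xs))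
  sum-updateAt xs (suc i) x = trans (∙-congˡ (sum-updateAt (tail xs) i x)) (x∙yz≈y∙xz (xs zero) x _)

module Sumsets {c ℓ} (G : AbelianGroup c ℓ) where

  open import Level using (Lift; lift; _⊔_)
  open import Data.Nat.Properties using (≤-trans; ≤-reflexive)
  open import Data.List using (lookup)
  open import Data.List.Membership.Propositional using (find; lose)
  open import Data.List.Membership.Propositional.Properties using (∈-lookup; ∈-cartesianProductWith⁺)
  open import Data.List.Relation.Unary.Any as Any using (Any; here; there)
  open import Data.List.Relation.Unary.Any.Properties using (lookup-index; map⁻; ++⁺ˡ; ++⁺ʳ; ++⁻; map⁺)
  open import Data.List.Relation.Unary.All using (lookupAny)
  open import Data.Sum using (inj₁; inj₂)
  open import Algebra.Properties.CommutativeMonoid.Sum +-0-commutativeMonoid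
    using () renaming (sum-replicate-zero to ∑ℕ-replicate-zero)
  open AbelianGroup G
  open GAP G
  open import Algebra.Definitions.RawMonoid rawMonoid using (sum) renaming (_×_ to _·_)
  open import Algebra.Properties.CommutativeMonoid.Sum commutativeMonoid
    using (sum-cong-≋; ∑-distrib-+; sum-replicate; sum-replicate-zero)
  open import Algebra.Properties.Monoid.Mult monoid using (×-homo-+)
  open import Algebra.Solver.CommutativeMonoid commutativeMonoid using (solve; _⊕_; _⊜_)
  open import Relation.Binary.Reasoning.Setoid setoid

  ⋃ : ∀ {s} → (Fin s → Pred) → Pred
  ⋃ B x = Σ (Fin _) λ j → B j x

  linear : ULin → Pred
  linear U x = Lift c (x ∈U U)

  Span : ULin → Carrier → Set ℓ
  Span (ulin d _ b) p = Σ (Fin d → ℕ) λ n → p ≈ sum (λ j → n j · b j)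

  module _ (A : Pred) where

    ⊗-resp-≈ : ∀ {m x y} → (m ⊗ A) x → x ≈ y → (m ⊗ A) y
    ⊗-resp-≈ (zs , zs∈A , x≈∑zs) x≈y = zs , zs∈A , trans (sym x≈y) x≈∑zs

    0⊗ : (0 ⊗ A) ε
    0⊗ = (λ ()) , (λ ()) , refl

    ⊗-cons : ∀ {m x y} → A x → (m ⊗ A) y → (suc m ⊗ A) (x ∙ y)
    ⊗-cons x∈A (zs , zs∈A , y≈∑zs) = (_ ◂ zs) , (λ { zero → x∈A ; (suc k) → zs∈A k }) , ∙-congˡ y≈∑zs

    ⊗-+ : ∀ m {n x y} → (m ⊗ A) x → (n ⊗ A) y → ((m + n) ⊗ A) (x ∙ y)
    ⊗-+ zero    (_ , _ , x≈ε) y∈ = ⊗-resp-≈ y∈ (trans (sym (identityˡ _)) (∙-congʳ (sym x≈ε)))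
    ⊗-+ (suc m) (zs , zs∈A , x≈∑zs) y∈ =
      ⊗-resp-≈ (⊗-cons (zs∈A zero) (⊗-+ m (tail zs , zs∈A ∘ suc , refl) y∈))
               (trans (sym (assoc _ _ _)) (∙-congʳ (sym x≈∑zs)))

    ⊗-replicate : ∀ {x} m → A x → (m ⊗ A) (m · x)
    ⊗-replicate m x∈A = (λ _ → _) , (λ _ → x∈A) , sym (sum-replicate m)

    ⊗-sum : ∀ {s} (k : Fin s → ℕ) {ys} → (∀ j → (k j ⊗ A) (ys j)) → (∑ℕ k ⊗ A) (sum ys)
    ⊗-sum {zero}  k ys∈ = 0⊗
    ⊗-sum {suc s} k ys∈ = ⊗-+ (k zero) (ys∈ zero) (⊗-sum (tail k) (ys∈ ∘ suc))

  ⊗-mono : ∀ {A B : Pred} {m x} → (∀ {y} → A y → B y) → (m ⊗ A) x → (m ⊗ B) x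
  ⊗-mono A⊆B (zs , zs∈A , x≈∑zs) = zs , (λ k → A⊆B (zs∈A k)) , x≈∑zs

  ⊗-⋃⁺ : ∀ {s} (B : Fin s → Pred) k {y} → dotSum s k B y → (∑ℕ k ⊗ ⋃ B) y
  ⊗-⋃⁺ B k (ys , ys∈ , y≈∑ys) = ⊗-resp-≈ (⋃ B) (⊗-sum (⋃ B) k (λ j → ⊗-mono {B j} {⋃ B} (j ,_) (ys∈ j))) (sym y≈∑ys)

  ⊗-⋃⁻ : ∀ {s} (B : Fin s → Pred) m {y} → (m ⊗ ⋃ B) y → Σ (Fin s → ℕ) λ k → ∑ℕ k ≡ m × dotSum s k B y
  ⊗-⋃⁻ {s} B zero (_ , _ , y≈ε) =
    (λ _ → 0) , ∑ℕ-replicate-zero s , (λ j → ε) , (λ j → 0⊗ (B j)) , trans y≈ε (sym (sum-replicate-zero s))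
  ⊗-⋃⁻ B (suc m) (zs , zs∈ , y≈∑zs) with zs∈ zero | ⊗-⋃⁻ B m (tail zs , zs∈ ∘ suc , refl)
  ... | J , z₀∈BJ | k , ∑k≡m , ys , ys∈ , ∑tail≈ =
    updateAt k J (1 +_) ,
    ≡.trans (sum-updateAt +-0-commutativeMonoid k J 1) (≡.cong suc ∑k≡m) ,
    updateAt ys J (zs zero ∙_) ,
    updateAt-pointwise (λ j k y → (k ⊗ B j) y) J ys∈ (⊗-cons (B J) z₀∈BJ (ys∈ J)) ,
    trans y≈∑zs (trans (∙-congˡ ∑tail≈) (sym (sum-updateAt commutativeMonoid ys J (zs zero))))

  module _ (U : ULin) where
    open ULin U renaming (base to a; gens to b)

    Span-ε : Span U ε
    Span-ε = (λ _ → 0) , sym (sum-replicate-zero dim)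

    Span-∙ : ∀ {p q} → Span U p → Span U q → Span U (p ∙ q)
    Span-∙ (n , p≈) (n′ , q≈) = (λ j → n j + n′ j) , (begin
      _ ∙ _                                                ≈⟨ ∙-cong p≈ q≈ ⟩
      sum (λ j → n j · b j) ∙ sum (λ j → n′ j · b j)       ≈⟨ ∑-distrib-+ (λ j → n j · b j) (λ j → n′ j · b j) ⟨
      sum (λ j → n j · b j ∙ n′ j · b j)                   ≈⟨ sum-cong-≋ (λ j → ×-homo-+ (b j) (n j) (n′ j)) ⟨
      sum (λ j → (n j + n′ j) · b j)                       ∎)

    base∈linear : linear U a
    base∈linear = lift ((λ _ → 0) , sym (trans (∙-congˡ (sum-replicate-zero dim)) (identityʳ a)))

    ⊗-linear⁻ : ∀ k {y} → (k ⊗ linear U) y → Σ Carrier λ p → Span U p × y ≈ k · a ∙ p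
    ⊗-linear⁻ zero    (_ , _ , y≈ε) = ε , Span-ε , trans y≈ε (sym (identityˡ ε))
    ⊗-linear⁻ (suc k) {y} (zs , zs∈ , y≈∑zs) with zs∈ zero | ⊗-linear⁻ k (tail zs , zs∈ ∘ suc , refl)
    ... | lift (n , z₀≈) | p , p∈Span , ∑tail≈ = q ∙ p , Span-∙ (n , refl) p∈Span , (begin
      y                                        ≈⟨ y≈∑zs ⟩
      zs zero ∙ sum (tail zs)                  ≈⟨ ∙-cong z₀≈ ∑tail≈ ⟩
      (a ∙ q) ∙ (k · a ∙ p)                    ≈⟨ solve 4 (λ a q ka p → (a ⊕ q) ⊕ (ka ⊕ p) ⊜ (a ⊕ ka) ⊕ (q ⊕ p)) refl a q (k · a) p ⟩
      (a ∙ k · a) ∙ (q ∙ p)                    ∎)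
      where q = sum (λ j → n j · b j)

    ⊗-linear⁺ : ∀ k {p} → Span U p → (suc k ⊗ linear U) (suc k · a ∙ p)
    ⊗-linear⁺ k (n , p≈) =
      ⊗-resp-≈ (linear U) (⊗-cons (linear U) (lift (n , ∙-congˡ p≈)) (⊗-replicate (linear U) k base∈linear))
        (solve 3 (λ a p ka → (a ⊕ p) ⊕ ka ⊜ (a ⊕ ka) ⊕ p) refl a _ (k · a))

    ⊗-linear-shift : ∀ {k h u v y} → (k ⊗ linear U) y → (h ≡ 0 → k ≡ 0) → k + v ≡ h + u →
      Σ Carrier λ z → (h ⊗ linear U) z × y ∙ v · a ≈ z ∙ u · a
    ⊗-linear-shift {h = zero} y∈ support v≡u with support ≡.refl
    ... | ≡.refl = ε , 0⊗ (linear U) , ∙-cong (proj₂ (proj₂ y∈)) (reflexive (≡.cong (_· a) v≡u))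
    ⊗-linear-shift {k} {suc h} {u} {v} {y} y∈ _ k+v≡h+u with ⊗-linear⁻ k y∈
    ... | p , p∈Span , y≈ = suc h · a ∙ p , ⊗-linear⁺ h p∈Span , (begin
      y ∙ v · a                 ≈⟨ ∙-congʳ y≈ ⟩
      (k · a ∙ p) ∙ v · a       ≈⟨ solve 3 (λ ka p va → (ka ⊕ p) ⊕ va ⊜ (ka ⊕ va) ⊕ p) refl (k · a) p (v · a) ⟩
      (k · a ∙ v · a) ∙ p       ≈⟨ ∙-congʳ (×-homo-+ a k v) ⟨
      (k + v) · a ∙ p           ≡⟨ ≡.cong (λ n → n · a ∙ p) k+v≡h+u ⟩
      (suc h + u) · a ∙ p       ≈⟨ ∙-congʳ (×-homo-+ a (suc h) u) ⟩
      (suc h · a ∙ u · a) ∙ p   ≈⟨ solve 3 (λ ha ua p → (ha ⊕ ua) ⊕ p ⊜ (ha ⊕ p) ⊕ ua) refl (suc h · a) (u · a) p ⟩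
      (suc h · a ∙ p) ∙ u · a   ∎)

  x∙v≈z∙u⇒x≈u∙v⁻¹∙z : ∀ {x v z u} → x ∙ v ≈ z ∙ u → x ≈ (u ∙ v ⁻¹) ∙ z
  x∙v≈z∙u⇒x≈u∙v⁻¹∙z {x} {v} {z} {u} x∙v≈z∙u = begin
    x                   ≈⟨ identityʳ x ⟨
    x ∙ ε               ≈⟨ ∙-congˡ (inverseʳ v) ⟨
    x ∙ (v ∙ v ⁻¹)      ≈⟨ assoc x v (v ⁻¹) ⟨
    (x ∙ v) ∙ v ⁻¹      ≈⟨ ∙-congʳ x∙v≈z∙u ⟩
    (z ∙ u) ∙ v ⁻¹      ≈⟨ solve 3 (λ z u v′ → (z ⊕ u) ⊕ v′ ⊜ (u ⊕ v′) ⊕ z) refl z u (v ⁻¹) ⟩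
    (u ∙ v ⁻¹) ∙ z      ∎

  _⊆_+_ : Pred → List Carrier → Pred → Set (c ⊔ ℓ)
  A ⊆ X + B = ∀ x → A x → Σ Carrier λ y → Any (λ x′ → x ≈ x′ ∙ y) X × B y

  AsymptoticApproxGroup : Pred → (r ℓ′ : ℕ) → Set (c ⊔ ℓ)
  AsymptoticApproxGroup A r ℓ′ = Σ ℕ λ h₀ → ∀ h → h₀ ≤ h →
    Σ (List Carrier) λ X → length X ≤ ℓ′ × ((r * h) ⊗ A) ⊆ X + (h ⊗ A)

  ⋃linear-approxGroup : ∀ {s} (L : Fin s → ULin) r →
    AsymptoticApproxGroup (⋃ (linear ∘ L)) (suc r) ((suc (suc r) * (s ∸ 1)) C (s ∸ 1))
  ⋃linear-approxGroup {s} L r with rebalancing s r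
  ... | h₀ , Δ-for = h₀ , λ h h₀≤h → let Δ , |Δ|≤ℓ , rebalance = Δ-for h h₀≤h in
    map translate Δ , ≤-trans (≤-reflexive (length-map translate Δ)) |Δ|≤ℓ , covered rebalance
    where
    A : Pred
    A = ⋃ (linear ∘ L)
    a : Fin s → Carrier
    a = ULin.base ∘ L
    combination : Vector ℕ s → Carrier
    combination u = sum (λ j → u j · a j)
    translate : Shift s → Carrier
    translate (u , v) = combination u ∙ combination v ⁻¹

    covered : ∀ {h Δ} → (∀ k → ∑ℕ k ≡ suc r * h → Rebalancing k h Δ) →
      ((suc r * h) ⊗ A) ⊆ map translate Δ + (h ⊗ A)
    covered rebalance y y∈ with ⊗-⋃⁻ (linear ∘ L) _ y∈
    ... | k , ∑k≡[1+r]h , ys , ys∈ , y≈∑ys =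
      sum zs , lose (∈-map⁺ translate shift∈Δ) (x∙v≈z∙u⇒x≈u∙v⁻¹∙z y∙down≈zs∙up) ,
      ≡.subst (λ m → (m ⊗ A) (sum zs)) ∑target (⊗-⋃⁺ (linear ∘ L) target (zs , proj₁ ∘ proj₂ ∘ shifted , refl))
      where
      open Rebalancing (rebalance k ∑k≡[1+r]h)
      shifted : ∀ j → Σ Carrier λ z → (target j ⊗ linear (L j)) z × ys j ∙ down j · a j ≈ z ∙ up j · a j
      shifted j = ⊗-linear-shift (L j) (ys∈ j) (support j) (balance j)
      zs : Fin s → Carrier
      zs = proj₁ ∘ shifted
      y∙down≈zs∙up : y ∙ combination down ≈ sum zs ∙ combination up
      y∙down≈zs∙up = begin
        y ∙ combination down                      ≈⟨ ∙-congʳ y≈∑ys ⟩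
        sum ys ∙ combination down                 ≈⟨ ∑-distrib-+ ys _ ⟨
        sum (λ j → ys j ∙ down j · a j)           ≈⟨ sum-cong-≋ (proj₂ ∘ proj₂ ∘ shifted) ⟩
        sum (λ j → zs j ∙ up j · a j)             ≈⟨ ∑-distrib-+ zs _ ⟩
        sum zs ∙ combination up                   ∎

  AsymptoticApproxGroup-resp : ∀ {A B : Pred} {r ℓ′} → (∀ {x} → A x → B x) → (∀ {x} → B x → A x) →
    AsymptoticApproxGroup A r ℓ′ → AsymptoticApproxGroup B r ℓ′
  AsymptoticApproxGroup-resp {A} {B} A⊆B B⊆A (h₀ , cover) = h₀ , λ h h₀≤h →
    let X , |X|≤ℓ′ , rhA⊆X+hA = cover h h₀≤h in
    X , |X|≤ℓ′ , λ y y∈ → let z , y∈X+z , z∈ = rhA⊆X+hA y (⊗-mono {B} {A} B⊆A y∈) in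
                          z , y∈X+z , ⊗-mono {A} {B} A⊆B z∈

  sums : ∀ q → (Fin q → List Carrier) → List Carrier
  sums zero    X = [ ε ]
  sums (suc q) X = cartesianProductWith _∙_ (X zero) (sums q (tail X))

  length-sums : ∀ q X → length (sums q X) ≡ prodFin q (length ∘ X)
  length-sums zero    X = ≡.refl
  length-sums (suc q) X = ≡.trans (length-cartesianProductWith _∙_ (X zero) (sums q (tail X)))
                                  (≡.cong (length (X zero) *_) (length-sums q (tail X)))

  sum-∈-sums : ∀ q X {xs} → (∀ i → xs i ∈ X i) → sum xs ∈ sums q X
  sum-∈-sums zero    X xs∈X = here ≡.refl
  sum-∈-sums (suc q) X xs∈X = ∈-cartesianProductWith⁺ _∙_ (xs∈X zero) (sum-∈-sums q (tail X) (xs∈X ∘ suc))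

  approxGroups⇒chromatic : ∀ q (𝒜 : Fin q → Pred) r (ℓs : Fin q → ℕ) →
    (∀ i → AsymptoticApproxGroup (𝒜 i) r (ℓs i)) → ChromaticAsymptoticApproxGroup q 𝒜 r (prodFin q ℓs)
  approxGroups⇒chromatic q 𝒜 r ℓs approx = proj₁ ∘ approx , covering
    where
    covering : ∀ h → (∀ i → proj₁ (approx i) ≤ h i) → Σ (List Carrier) λ X →
      length X ≤ prodFin q ℓs × dotSum q (λ i → r * h i) 𝒜 ⊆ X + dotSum q h 𝒜
    covering h h₀≤h = sums q X , ≤-trans (≤-reflexive (length-sums q X)) (prodFin-mono-≤ q |X|≤ℓs) , covered
      where
      X : Fin q → List Carrier
      X i = proj₁ (proj₂ (approx i) (h i) (h₀≤h i))
      |X|≤ℓs : ∀ i → length (X i) ≤ ℓs i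
      |X|≤ℓs i = proj₁ (proj₂ (proj₂ (approx i) (h i) (h₀≤h i)))
      covers : ∀ i → ((r * h i) ⊗ 𝒜 i) ⊆ X i + (h i ⊗ 𝒜 i)
      covers i = proj₂ (proj₂ (proj₂ (approx i) (h i) (h₀≤h i)))

      covered : dotSum q (λ i → r * h i) 𝒜 ⊆ sums q X + dotSum q h 𝒜
      covered y (ys , ys∈ , y≈∑ys) =
        sum zs , lose (sum-∈-sums q X (proj₁ ∘ proj₂ ∘ found)) y≈∑xs∙∑zs , zs , proj₂ ∘ proj₂ ∘ split , refl
        where
        split : ∀ i → Σ Carrier λ z → Any (λ x → ys i ≈ x ∙ z) (X i) × (h i ⊗ 𝒜 i) z
        split i = covers i (ys i) (ys∈ i)
        zs : Fin q → Carrier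
        zs = proj₁ ∘ split
        found : ∀ i → Σ Carrier λ x → x ∈ X i × ys i ≈ x ∙ zs i
        found i = find (proj₁ (proj₂ (split i)))
        xs : Fin q → Carrier
        xs = proj₁ ∘ found
        y≈∑xs∙∑zs : y ≈ sum xs ∙ sum zs
        y≈∑xs∙∑zs = begin
          y                           ≈⟨ y≈∑ys ⟩
          sum ys                      ≈⟨ sum-cong-≋ (proj₂ ∘ proj₂ ∘ found) ⟩
          sum (λ i → xs i ∙ zs i)     ≈⟨ ∑-distrib-+ xs zs ⟩
          sum xs ∙ sum zs             ∎

  ·ε≈ε : ∀ n → n · ε ≈ ε
  ·ε≈ε n = trans (sym (sum-replicate n)) (sum-replicate-zero n)

  ∈U-single⁻ : ∀ {x y} → y ∈U single x → y ≈ x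
  ∈U-single⁻ {x} (n , y≈) =
    trans y≈ (trans (∙-congˡ (trans (sum-cong-≋ (·ε≈ε ∘ n)) (sum-replicate-zero 1))) (identityʳ x))

  ∈U-single⁺ : ∀ {x y} → y ≈ x → y ∈U single x
  ∈U-single⁺ {x} y≈x = (λ _ → 0) , trans y≈x (sym (trans (∙-congˡ (sum-replicate-zero 1)) (identityʳ x)))

  ∈B-resp-≈ : ∀ {B x y} → x ≈ y → y ∈B B → x ∈B B
  ∈B-resp-≈ {bgap _ _ _ _} x≈y (n , n≤m , y≈) = n , n≤m , trans x≈y y≈

  ∈P⇒∈U : ∀ {ps qs x} → Refines ps qs → Any (x ∈P_) ps → Any (x ∈U_) qs
  ∈P⇒∈U (unbʳ R)                       (here x∈U)   = here x∈U
  ∈P⇒∈U (unbʳ R)                       (there x∈ps) = there (∈P⇒∈U R x∈ps)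
  ∈P⇒∈U (bndʳ (covers , _ , _) R)      (here x∈B)   = ++⁺ˡ (map⁺ (Any.map ∈U-single⁺ (covers _ x∈B)))
  ∈P⇒∈U (bndʳ {xs = xs} _ R)           (there x∈ps) = ++⁺ʳ (map single xs) (∈P⇒∈U R x∈ps)

  ∈U⇒∈P : ∀ {ps qs x} → Refines ps qs → Any (x ∈U_) qs → Any (x ∈P_) ps
  ∈U⇒∈P (unbʳ R) (here x∈U)   = here x∈U
  ∈U⇒∈P (unbʳ R) (there x∈qs) = there (∈U⇒∈P R x∈qs)
  ∈U⇒∈P (bndʳ {xs = xs} (_ , xs∈B , _) R) x∈ with ++⁻ (map single xs) x∈
  ... | inj₁ x∈singles = let x′∈B , x∈single = lookupAny xs∈B (map⁻ x∈singles) in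
                         here (∈B-resp-≈ (∈U-single⁻ x∈single) x′∈B)
  ... | inj₂ x∈qs      = there (∈U⇒∈P R x∈qs)

  ⟦⟧⊆⋃ : ∀ {ps qs} → Refines ps qs → ∀ {x} → ⟦ ps ⟧ x → ⋃ (linear ∘ lookup qs) x
  ⟦⟧⊆⋃ R (lift x∈ps) = let x∈qs = ∈P⇒∈U R x∈ps in Any.index x∈qs , lift (lookup-index x∈qs)

  ⋃⊆⟦⟧ : ∀ {ps qs} → Refines ps qs → ∀ {x} → ⋃ (linear ∘ lookup qs) x → ⟦ ps ⟧ x
  ⋃⊆⟦⟧ R (j , lift x∈qsj) = lift (∈U⇒∈P R (lose (∈-lookup j) x∈qsj))

  ⟦⟧-approxGroup : ∀ {ps qs} → Refines ps qs → ∀ r →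
    AsymptoticApproxGroup ⟦ ps ⟧ (suc r) ((suc (suc r) * (length qs ∸ 1)) C (length qs ∸ 1))
  ⟦⟧-approxGroup {ps} {qs} R r =
    AsymptoticApproxGroup-resp {⋃ (linear ∘ lookup qs)} {⟦ ps ⟧} {suc r} (⋃⊆⟦⟧ R) (⟦⟧⊆⋃ R) (⋃linear-approxGroup (lookup qs) r)

open Sumsets using (approxGroups⇒chromatic; ⟦⟧-approxGroup)

corollary2p15 : ∀ {c ℓ : Level} (G : AbelianGroup c ℓ) (q : ℕ)
    (ps : Fin q → List (GAP.Piece G)) (qs : Fin q → List (GAP.ULin G)) →
    (∀ i → GAP.Refines G (ps i) (qs i)) →
    (r : ℕ) → 1 ≤ r →
    GAP.ChromaticAsymptoticApproxGroup G q (λ i → GAP.⟦_⟧ G (ps i)) r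
      (GAP.ellBound G q (λ i → length (qs i)) r)
corollary2p15 G q ps qs refines (suc r) _ =
  approxGroups⇒chromatic G q (λ i → GAP.⟦_⟧ G (ps i)) (suc r) _ λ i → ⟦⟧-approxGroup G (refines i) r
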